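{- Let $G$ be a graph and let $v$ and $u$ be vertices of $G$ such that $v$ dominates $u$, i.e. $N[u]\subseteq N[v]$. Then there is a minimum cPCP-set of $G$ that either contains $v$ or contains neither $v$ nor $u$.
   Context: All graphs are simple and undirected; $N[x]$ denotes the closed neighborhood $N(x)\cup\{x\}$. A vertex set $S$ is a cPCP-set of $G$ if $G\setminus S$ has maximum degree at most 2; a minimum cPCP-set is one of minimum cardinality. -}

module Defs where

open import Data.Nat using (ℕ; suc; _≤_)
open import Data.Bool using (Bool; true; false; T; not; _∧_)
open import Data.Fin using (Fin)
open import Data.Fin.Subset using (Subset; _∈_; _∉_; ∣_∣)
open import Data.Vec using (Vec; []; _∷_; lookup; tabulate)
open import Data.Product using (_×_)
open import Relation.Binary.PropositionalEquality using (_≡_)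

record Graph (n : ℕ) : Set where
  field
    adj   : Fin n → Fin n → Bool
    irrefl : ∀ x → adj x x ≡ false
    sym   : ∀ x y → adj x y ≡ adj y x
open Graph public

Adj : ∀ {n} → Graph n → Fin n → Fin n → Set
Adj G x y = T (adj G x y)

data InClosedNbhd {n} (G : Graph n) (x : Fin n) : Fin n → Set where
  self : InClosedNbhd G x x
  nbr  : ∀ {y} → Adj G x y → InClosedNbhd G x y

Dominates : ∀ {n} → Graph n → Fin n → Fin n → Set
Dominates G v u = ∀ w → InClosedNbhd G u w → InClosedNbhd G v w

countTrue : ∀ {m} → Vec Bool m → ℕ
countTrue [] = 0
countTrue (true ∷ bs) = suc (countTrue bs)
countTrue (false ∷ bs) = countTrue bs

-- Degree of x in G ∖ S : number of vertices y ∉ S adjacent to x.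
degMinus : ∀ {n} → Graph n → Subset n → Fin n → ℕ
degMinus {n} G S x = countTrue (tabulate λ y → adj G x y ∧ not (lookup S y))


IsCPCP : ∀ {n} → Graph n → Subset n → Set
IsCPCP G S = ∀ x → x ∉ S → degMinus G S x ≤ 2

IsMinCPCP : ∀ {n} → Graph n → Subset n → Set
IsMinCPCP G S = IsCPCP G S × (∀ T → IsCPCP G T → ∣ S ∣ ≤ ∣ T ∣)

-- Take a minimum cPCP-set S.  If v ∈ S, or u ∉ S, we are done.  Otherwise
-- v ∉ S and u ∈ S, and S' = (S ∖ {u}) ∪ {v} is no larger than S.  It is again
-- a cPCP-set: every vertex x ≠ v loses the neighbour v in G ∖ S' and gains at
-- most u, but whenever x is adjacent to u it is adjacent to v as well, since
-- N[u] ⊆ N[v]; and u itself, being outside S', has in G ∖ S' only neighbours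
-- that are neighbours of v in G ∖ S.
module Submission where

open import Defs hiding (sym)
open import Data.Nat using (ℕ; zero; suc; _≤_; _≤?_; _<?_; z≤n; s≤s)
open import Data.Nat.Properties using (≤-refl; ≤-reflexive; ≤-trans; ≤-pred; n≤1+n; <-≤-trans; ≮⇒≥)
open import Data.Bool using (T; not; _∧_)
open import Data.Bool.Properties using (T-≡)
open import Data.Fin using (Fin; zero; suc)
open import Data.Fin.Properties using (all?) renaming (_≟_ to _≟ᶠ_)
open import Data.Fin.Subset
  using (Subset; inside; outside; _∈_; _∉_; _⊆_; ∣_∣; ⊤; ⁅_⁆; ∁; _∩_; _∪_; _─_; _-_)
open import Data.Fin.Subset.Properties
  using ( _∈?_; anySubset?; ∈⊤; x∈⁅x⁆; x∈⁅y⁆⇒x≡y; x∉⁅y⁆⇒x≢y; x∈p∩q⁺; x∈p∩q⁻; x∈p∪q⁺; x∈p∪q⁻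
        ; x∉p⇒x∈∁p; x∈∁p⇒x∉p; p─q⊆p; x∈p∧x≢y⇒x∈p-y
        ; p⊆q⇒∣p∣≤∣q∣; x∈p⇒∣p-x∣<∣p∣; p─⊥≡p)
open import Data.Vec using ([]; _∷_; there; lookup; tabulate)
open import Data.Vec.Properties
  using (lookup∘tabulate; tabulate∘lookup; tabulate-cong; lookup-zipWith; lookup-map; lookup⇒[]=; []=⇒lookup)
open import Data.Product using (∃; _×_; _,_)
open import Data.Sum using (_⊎_; inj₁; inj₂)
open import Function using (_∘_; Equivalence)
open import Level using (Level)
open import Relation.Nullary using (¬_; yes; no; contradiction)
open import Relation.Nullary.Decidable using (_→-dec_; ¬?; _×-dec_)
open import Relation.Unary using (Pred; Decidable)
open import Relation.Binary.PropositionalEquality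
  using (_≡_; _≢_; refl; sym; trans; cong; cong₂; subst; subst₂; module ≡-Reasoning)

private
  variable
    n : ℕ
    ℓ : Level

countTrue≡∣∣ : (p : Subset n) → countTrue p ≡ ∣ p ∣
countTrue≡∣∣ []            = refl
countTrue≡∣∣ (inside  ∷ p) = cong suc (countTrue≡∣∣ p)
countTrue≡∣∣ (outside ∷ p) = countTrue≡∣∣ p

x∈p─q⇒x∉q : ∀ {x : Fin n} (p q : Subset n) → x ∈ p ─ q → x ∉ q
x∈p─q⇒x∉q (_ ∷ p) (inside  ∷ q) (there x∈p─q) (there x∈q) = x∈p─q⇒x∉q p q x∈p─q x∈q
x∈p─q⇒x∉q (_ ∷ p) (outside ∷ q) (there x∈p─q) (there x∈q) = x∈p─q⇒x∉q p q x∈p─q x∈q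

x∈p-y⇒x≢y : ∀ {x y : Fin n} (p : Subset n) → x ∈ p - y → x ≢ y
x∈p-y⇒x≢y {y = y} p = x∉⁅y⁆⇒x≢y ∘ x∈p─q⇒x∉q p ⁅ y ⁆

∣p∣≤1+∣p-x∣ : (p : Subset n) (x : Fin n) → ∣ p ∣ ≤ suc ∣ p - x ∣
∣p∣≤1+∣p-x∣ (inside  ∷ p) zero    = s≤s (≤-reflexive (cong ∣_∣ (sym (p─⊥≡p p))))
∣p∣≤1+∣p-x∣ (outside ∷ p) zero    = ≤-trans (≤-reflexive (cong ∣_∣ (sym (p─⊥≡p p)))) (n≤1+n _)
∣p∣≤1+∣p-x∣ (inside  ∷ p) (suc x) = s≤s (∣p∣≤1+∣p-x∣ p x)
∣p∣≤1+∣p-x∣ (outside ∷ p) (suc x) = ∣p∣≤1+∣p-x∣ p x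

p-y⊆q-x⇒∣p∣≤∣q∣ : ∀ {p q : Subset n} {x y} → p - y ⊆ q - x → (y ∈ p → x ∈ q) → ∣ p ∣ ≤ ∣ q ∣
p-y⊆q-x⇒∣p∣≤∣q∣ {p = p} {q} {x} {y} p-y⊆q-x y∈p⇒x∈q with y ∈? p
... | yes y∈p = ≤-trans (∣p∣≤1+∣p-x∣ p y)
                        (<-≤-trans (s≤s (p⊆q⇒∣p∣≤∣q∣ p-y⊆q-x)) (x∈p⇒∣p-x∣<∣p∣ (y∈p⇒x∈q y∈p)))
... | no  y∉p = p⊆q⇒∣p∣≤∣q∣ (p─q⊆p q ⁅ x ⁆ ∘ p-y⊆q-x ∘ λ z∈p → x∈p∧x≢y⇒x∈p-y z∈p (λ { refl → y∉p z∈p }))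

∃-minimal-∣∣ : {P : Pred (Subset n) ℓ} → Decidable P → ∃ P →
               ∃ λ S → P S × (∀ T → P T → ∣ S ∣ ≤ ∣ T ∣)
∃-minimal-∣∣ {P = P} P? (S , PS) = descend ∣ S ∣ S PS ≤-refl
  where
  descend : ∀ k S → P S → ∣ S ∣ ≤ k → ∃ λ S → P S × (∀ T → P T → ∣ S ∣ ≤ ∣ T ∣)
  descend zero    S PS ∣S∣≤0 = S , PS , λ _ _ → ≤-trans ∣S∣≤0 z≤n
  descend (suc k) S PS ∣S∣≤1+k with anySubset? (λ T → P? T ×-dec (∣ T ∣ <? ∣ S ∣))
  ... | yes (T , PT , ∣T∣<∣S∣) = descend k T PT (≤-pred (≤-trans ∣T∣<∣S∣ ∣S∣≤1+k))
  ... | no  ∄smaller          = S , PS , λ T PT → ≮⇒≥ (λ ∣T∣<∣S∣ → ∄smaller (T , PT , ∣T∣<∣S∣))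

replace : Subset n → Fin n → Fin n → Subset n
replace S u v = (S - u) ∪ ⁅ v ⁆

module _ {S : Subset n} {u v : Fin n} where

  ∈replace : v ∈ replace S u v
  ∈replace = x∈p∪q⁺ (inj₂ (x∈⁅x⁆ v))

  ∈replace⁺ : ∀ {x} → x ∈ S → x ≢ u → x ∈ replace S u v
  ∈replace⁺ x∈S x≢u = x∈p∪q⁺ (inj₁ (x∈p∧x≢y⇒x∈p-y x∈S x≢u))

  ∈replace⁻ : ∀ {x} → x ∈ replace S u v → x ≢ v → x ∈ S - u
  ∈replace⁻ x∈R x≢v with x∈p∪q⁻ (S - u) ⁅ v ⁆ x∈R
  ... | inj₁ x∈S-u = x∈S-u
  ... | inj₂ x∈⁅v⁆ = contradiction (x∈⁅y⁆⇒x≡y v x∈⁅v⁆) x≢v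

  ∣replace∣≤∣∣ : u ∈ S → ∣ replace S u v ∣ ≤ ∣ S ∣
  ∣replace∣≤∣∣ u∈S = p-y⊆q-x⇒∣p∣≤∣q∣
    (λ x∈R-v → ∈replace⁻ (p─q⊆p _ ⁅ v ⁆ x∈R-v) (x∈p-y⇒x≢y (replace S u v) x∈R-v))
    (λ _ → u∈S)

module _ (G : Graph n) where

  Adj-sym : ∀ {x y} → Adj G x y → Adj G y x
  Adj-sym {x} {y} = subst T (Graph.sym G x y)

  Adj-irrefl : ∀ {x} → ¬ Adj G x x
  Adj-irrefl {x} = subst T (Graph.irrefl G x)

  dominates⇒Adj : ∀ {v u x} → Dominates G v u → x ≢ v → Adj G u x → Adj G v x
  dominates⇒Adj {x = x} dom x≢v u~x with dom x (nbr u~x)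
  ... | self    = contradiction refl x≢v
  ... | nbr v~x = v~x

  nbrs : Fin n → Subset n
  nbrs x = tabulate (adj G x)

  ∈nbrs⁺ : ∀ {x y} → Adj G x y → y ∈ nbrs x
  ∈nbrs⁺ {x} {y} x~y = lookup⇒[]= y (nbrs x) (trans (lookup∘tabulate (adj G x) y) (Equivalence.to T-≡ x~y))

  ∈nbrs⁻ : ∀ {x y} → y ∈ nbrs x → Adj G x y
  ∈nbrs⁻ {x} {y} y∈N = Equivalence.from T-≡ (trans (sym (lookup∘tabulate (adj G x) y)) ([]=⇒lookup y∈N))

  degMinus≡∣nbrs∩∁∣ : ∀ S x → degMinus G S x ≡ ∣ nbrs x ∩ ∁ S ∣
  degMinus≡∣nbrs∩∁∣ S x = begin
    degMinus G S x                                   ≡⟨ countTrue≡∣∣ (tabulate (λ y → adj G x y ∧ not (lookup S y))) ⟩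
    ∣ tabulate (λ y → adj G x y ∧ not (lookup S y)) ∣ ≡⟨ cong ∣_∣ (tabulate-cong lookup-nbrs∩∁) ⟨
    ∣ tabulate (lookup (nbrs x ∩ ∁ S)) ∣             ≡⟨ cong ∣_∣ (tabulate∘lookup (nbrs x ∩ ∁ S)) ⟩
    ∣ nbrs x ∩ ∁ S ∣                                 ∎
    where
    open ≡-Reasoning
    lookup-nbrs∩∁ : ∀ y → lookup (nbrs x ∩ ∁ S) y ≡ (adj G x y ∧ not (lookup S y))
    lookup-nbrs∩∁ y = trans (lookup-zipWith _∧_ y (nbrs x) (∁ S))
                            (cong₂ _∧_ (lookup∘tabulate (adj G x) y) (lookup-map y not S))

  degMinus-≤ : ∀ {S T x y} → ∣ nbrs x ∩ ∁ S ∣ ≤ ∣ nbrs y ∩ ∁ T ∣ → degMinus G S x ≤ degMinus G T y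
  degMinus-≤ {S} {T} {x} {y} = subst₂ _≤_ (sym (degMinus≡∣nbrs∩∁∣ S x)) (sym (degMinus≡∣nbrs∩∁∣ T y))

  ∈nbrs∩∁⁺ : ∀ {S x y} → Adj G x y → y ∉ S → y ∈ nbrs x ∩ ∁ S
  ∈nbrs∩∁⁺ x~y y∉S = x∈p∩q⁺ (∈nbrs⁺ x~y , x∉p⇒x∈∁p y∉S)

  ∈nbrs∩∁⁻ : ∀ {S x y} → y ∈ nbrs x ∩ ∁ S → Adj G x y × y ∉ S
  ∈nbrs∩∁⁻ {S} {x} y∈ with x∈p∩q⁻ (nbrs x) (∁ S) y∈
  ... | y∈N , y∈∁S = ∈nbrs⁻ y∈N , x∈∁p⇒x∉p y∈∁S

  module _ {S : Subset n} {v u : Fin n} (dom : Dominates G v u) where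

    private
      R : Subset n
      R = replace S u v

      ∉replace⇒∉ : ∀ {y} → y ∉ R → y ≢ u → y ∉ S
      ∉replace⇒∉ y∉R y≢u y∈S = y∉R (∈replace⁺ y∈S y≢u)

      ∉replace⇒≢ : ∀ {y} → y ∉ R → y ≢ v
      ∉replace⇒≢ y∉R refl = y∉R ∈replace

    nbrs∩∁replace⊆ : nbrs u ∩ ∁ R ⊆ nbrs v ∩ ∁ S
    nbrs∩∁replace⊆ y∈ with ∈nbrs∩∁⁻ y∈
    ... | u~y , y∉R = ∈nbrs∩∁⁺ (dominates⇒Adj dom (∉replace⇒≢ y∉R) u~y)
                               (∉replace⇒∉ y∉R λ { refl → Adj-irrefl u~y })

    ∣nbrs∩∁replace∣≤ : ∀ {x} → x ≢ v → v ∉ S → ∣ nbrs x ∩ ∁ R ∣ ≤ ∣ nbrs x ∩ ∁ S ∣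
    ∣nbrs∩∁replace∣≤ {x} x≢v v∉S = p-y⊆q-x⇒∣p∣≤∣q∣ {y = u} trade u-gained⇒v-lost
      where
      trade : (nbrs x ∩ ∁ R) - u ⊆ (nbrs x ∩ ∁ S) - v
      trade y∈ with ∈nbrs∩∁⁻ (p─q⊆p _ ⁅ u ⁆ y∈)
      ... | x~y , y∉R = x∈p∧x≢y⇒x∈p-y
        (∈nbrs∩∁⁺ x~y (∉replace⇒∉ y∉R (x∈p-y⇒x≢y (nbrs x ∩ ∁ R) y∈))) (∉replace⇒≢ y∉R)
      u-gained⇒v-lost : u ∈ nbrs x ∩ ∁ R → v ∈ nbrs x ∩ ∁ S
      u-gained⇒v-lost u∈ with ∈nbrs∩∁⁻ u∈
      ... | x~u , _ = ∈nbrs∩∁⁺ (Adj-sym (dominates⇒Adj dom x≢v (Adj-sym x~u))) v∉S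

    replace-isCPCP : v ∉ S → IsCPCP G S → IsCPCP G R
    replace-isCPCP v∉S cS x x∉R with x ≟ᶠ u
    ... | yes refl = ≤-trans (degMinus-≤ (p⊆q⇒∣p∣≤∣q∣ nbrs∩∁replace⊆)) (cS v v∉S)
    ... | no  x≢u  = ≤-trans (degMinus-≤ (∣nbrs∩∁replace∣≤ (∉replace⇒≢ x∉R) v∉S))
                             (cS x (∉replace⇒∉ x∉R x≢u))

isCPCP? : (G : Graph n) → Decidable (IsCPCP G)
isCPCP? G S = all? (λ x → ¬? (x ∈? S) →-dec (degMinus G S x ≤? 2))

lemma10 : ∀ {n} (G : Graph n) (v u : Fin n) → Dominates G v u →
    ∃ λ S → IsMinCPCP G S × (v ∈ S ⊎ (v ∉ S × u ∉ S))
lemma10 G v u dom with ∃-minimal-∣∣ (isCPCP? G) (⊤ , λ _ x∉⊤ → contradiction ∈⊤ x∉⊤)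
... | S , cS , minS with v ∈? S | u ∈? S
... | yes v∈S | _       = S , (cS , minS) , inj₁ v∈S
... | no  v∉S | no  u∉S = S , (cS , minS) , inj₂ (v∉S , u∉S)
... | no  v∉S | yes u∈S =
  replace S u v , (replace-isCPCP G dom v∉S cS , λ T cT → ≤-trans (∣replace∣≤∣∣ u∈S) (minS T cT)) , inj₁ ∈replace
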